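{- Consider the bridge-burning game on the grid $G_{2,n}$, and suppose two cops start in the same row in columns whose indices differ by $k$, where $k\le 9$. If the robber starts in a column strictly between the columns of these two cops, then the cops can capture him.
   Context: Bridge-burning Cops and Robbers is played on a finite graph $G$ by a team of cops and a single robber, with full information. First each cop chooses a starting vertex (several cops may share a vertex), then the robber chooses a starting vertex. The game then proceeds in rounds; in each round, first every cop either stays put or moves along an edge of the current graph to an adjacent vertex, and then the robber either stays put or moves along an edge of the current graph. Every edge traversed by the robber is immediately deleted from the graph (cop moves delete nothing). The cops win if at some moment some cop occupies the same vertex as the robber; the robber wins if he avoids this forever. The grid $G_{m,n}$ is the Cartesian product $P_n\,\Box\,P_m$, with vertex set $\{(i,j):0\le i\le n-1,\ 0\le j\le m-1\}$, where $(i,j)$ is adjacent to $(i',j')$ iff $|i-i'|+|j-j'|=1$. Vertex $(i,j)$ lies in column $i$ and row $j$. So $G_{2,n}$ has 2 rows and $n$ columns. -}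

module Defs where

open import Data.Nat using (ℕ; _+_; ∣_-_∣)
open import Data.Fin using (Fin; toℕ)
open import Data.Product using (_×_; _,_)
open import Data.Sum using (_⊎_)
open import Data.List using (List; []; _∷_)
open import Data.List.Membership.Propositional using (_∈_)
open import Relation.Nullary using (¬_)
open import Relation.Binary.PropositionalEquality using (_≡_)

-- Vertices of the grid G_{2,n}: (column i, row j) with 0 ≤ i < n, 0 ≤ j < 2.
V : ℕ → Set
V n = Fin n × Fin 2

GridAdj : ∀ {n} → V n → V n → Set
GridAdj (i , j) (i' , j') = ∣ toℕ i - toℕ i' ∣ + ∣ toℕ j - toℕ j' ∣ ≡ 1

-- The set of edges deleted so far, as a list of (ordered) pairs; the
-- undirected edge {u,v} is deleted iff (u,v) or (v,u) occurs in the list.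
Burnt : ℕ → Set
Burnt n = List (V n × V n)

Deleted : ∀ {n} → Burnt n → V n → V n → Set
Deleted D u v = ((u , v) ∈ D) ⊎ ((v , u) ∈ D)

Edge : ∀ {n} → Burnt n → V n → V n → Set
Edge D u v = GridAdj u v × ¬ Deleted D u v

CopMove : ∀ {n} → Burnt n → V n → V n → Set
CopMove D u v = (u ≡ v) ⊎ Edge D u v

-- CopWin D c₁ c₂ r : in the position where the current set of deleted edges
-- is D, the two cops are at c₁ and c₂, the robber is at r, and it is the
-- cops' turn to move, the cops have a strategy guaranteeing capture
-- (inductive, i.e. capture in finitely many rounds, against every robber play).
data CopWin {n : ℕ} (D : Burnt n) (c₁ c₂ r : V n) : Set where
  caught : (c₁ ≡ r) ⊎ (c₂ ≡ r) → CopWin D c₁ c₂ r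
  move   : (c₁' c₂' : V n) → CopMove D c₁ c₁' → CopMove D c₂ c₂' →
           ((c₁' ≡ r) ⊎ (c₂' ≡ r))
           -- ... or every robber reply loses: staying put (deletes nothing)
           ⊎ (CopWin D c₁' c₂' r
              -- and moving along an edge (which deletes that edge)
              × ((r' : V n) → Edge D r r' →
                   (r' ≡ c₁') ⊎ (r' ≡ c₂') ⊎ CopWin ((r , r') ∷ D) c₁' c₂' r'))
           → CopWin D c₁ c₂ r

module Submission where

-- * Escape is hopeless (`chase`).  Once the robber leaves the block of
--   columns spanned by the cops, he does so along a row, burning the edge
--   behind him, from a vertex whose rung partner is occupied by a cop.  That
--   cop follows him in the other row; the robber can never turn back
--   (burnt edge) nor cross the rung (cop), so he is caught at the end of the
--   grid.  One argument serves both directions, phrased for an arbitrary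
--   column coordinate (`Coordinate`): the column index or its mirror image.
--
-- * Inside the block the game is finite.  We describe it abstractly by
--   column offsets from the left cop, encode cop strategies as finite trees
--   (`Cert`) and give a boolean checker (`Checker.wins`) whose acceptance
--   implies a concrete cop win for every n and every placement of the block
--   (`Soundness.wins-sound`); a robber leaving the block is handed to `chase`.
--
-- The theorem then follows from explicit certificates for all k ≤ 9 and all
-- robber starts, which the checker accepts by evaluation (`all-accepted`).

open import Defs
open import Data.Bool using (Bool; true; false; T; not; _∧_; _∨_)
open import Data.Bool.Properties using (T-∧; T-∨)
open import Data.Empty using (⊥-elim)
open import Data.Unit using (tt)
open import Data.Fin as Fin using (Fin; toℕ; fromℕ<; opposite)
open import Data.Fin.Properties using (toℕ-injective; toℕ<n; toℕ-fromℕ<; opposite-prop; opposite-involutive)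
open import Data.List using (List; []; _∷_)
open import Data.List.Membership.Propositional using (_∈_)
open import Data.List.Relation.Binary.Pointwise using (Pointwise; []; _∷_)
import Data.List.Relation.Binary.Pointwise.Properties as Pointwise
import Data.List.Membership.DecPropositional as DecMembership
open import Data.List.Relation.Unary.All as All using (All; []; _∷_)
open import Data.List.Relation.Unary.Any using (here; there)
open import Data.Nat as ℕ using (ℕ; zero; suc; pred; _+_; _∸_; _≤_; _<_; z≤n; s≤s; ∣_-_∣; _≤?_)
open import Data.Nat.Properties
  using (≤-refl; ≤-reflexive; ≤-trans; <⇒≤; ≤-<-trans; <-irrefl; n≤1+n; m≤m+n; suc-injective;
         +-identityʳ; +-suc; +-cancelˡ-≡; +-cancelʳ-≡; +-cancelˡ-<; +-monoʳ-≤; +-∸-assoc;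
         m∸n≤m; m∸[m∸n]≡n; m+[n∸m]≡n; m<n⇒0<n∸m; ∸-monoʳ-≤; pred-mono-≤; m<1+n⇒m<n∨m≡n;
         ∣n-n∣≡0; ∣m-n∣≡0⇒m≡n; ∣-∣-comm; m≤n⇒∣n-m∣≡n∸m)
open import Data.Product using (Σ; _×_; _,_; proj₁; proj₂)
open import Data.Product.Properties using (≡-dec)
open import Data.Sum as Sum using (_⊎_; inj₁; inj₂)
open import Function using (_∘_; Equivalence)
open import Relation.Binary using (DecidableEquality)
open import Relation.Binary.PropositionalEquality
open import Relation.Nullary using (¬_; Dec; yes; no)
open import Relation.Nullary.Decidable using (⌊_⌋; _⊎-dec_; toWitness; toWitnessFalse)

∧-elim : ∀ {x y} → T (x ∧ y) → T x × T y
∧-elim = Equivalence.to T-∧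

∨-elim : ∀ {x y} → T (x ∨ y) → T x ⊎ T y
∨-elim = Equivalence.to T-∨

distance-one : ∀ m n → ∣ m - n ∣ ≡ 1 → (n ≡ suc m) ⊎ (suc n ≡ m)
distance-one zero    n       e = inj₁ e
distance-one (suc m) zero    e = inj₂ (sym e)
distance-one (suc m) (suc n) e = Sum.map (cong suc) (cong suc) (distance-one m n e)

distance-suc : ∀ {m n} → m ≡ suc n → ∣ m - n ∣ ≡ 1
distance-suc {n = zero}  refl = refl
distance-suc {n = suc n} refl = distance-suc {n = n} refl

∣∸-∸∣ : ∀ {m a b} → a ≤ m → b ≤ m → ∣ m ∸ a - m ∸ b ∣ ≡ ∣ a - b ∣
∣∸-∸∣ {m}     z≤n       z≤n       = ∣n-n∣≡0 m
∣∸-∸∣         (s≤s a≤m) (s≤s b≤m) = ∣∸-∸∣ a≤m b≤m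
∣∸-∸∣ {suc m} {b = suc b} z≤n (s≤s b≤m) = begin
  ∣ suc m - m ∸ b ∣  ≡⟨ m≤n⇒∣n-m∣≡n∸m (≤-trans (m∸n≤m m b) (n≤1+n m)) ⟩
  suc m ∸ (m ∸ b)    ≡⟨ +-∸-assoc 1 (m∸n≤m m b) ⟩
  suc (m ∸ (m ∸ b))  ≡⟨ cong suc (m∸[m∸n]≡n b≤m) ⟩
  suc b              ∎
  where open ≡-Reasoning
∣∸-∸∣ {suc m} {suc a} (s≤s a≤m) z≤n = trans (∣-∣-comm (m ∸ a) (suc m)) (∣∸-∸∣ z≤n (s≤s a≤m))

∸-suc : ∀ {m n} → m < n → n ∸ m ≡ suc (n ∸ suc m)
∸-suc {zero}  {suc n} _         = refl
∸-suc {suc m} {suc n} (s≤s m<n) = ∸-suc m<n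

flip : Fin 2 → Fin 2
flip Fin.zero             = Fin.suc Fin.zero
flip (Fin.suc Fin.zero)   = Fin.zero

flip-≢ : ∀ j → flip j ≢ j
flip-≢ Fin.zero           ()
flip-≢ (Fin.suc Fin.zero) ()

module _ {n : ℕ} where

  same-column : ∀ {i i' : Fin n} → ∣ toℕ i - toℕ i' ∣ + 1 ≡ 1 → i' ≡ i
  same-column e = toℕ-injective (sym (∣m-n∣≡0⇒m≡n (+-cancelʳ-≡ 1 _ 0 e)))

  adjacent-cases : ∀ (i i' : Fin n) j j' → GridAdj (i , j) (i' , j') →
                   (i' ≡ i × j' ≡ flip j) ⊎ (∣ toℕ i - toℕ i' ∣ ≡ 1 × j' ≡ j)
  adjacent-cases _ _ Fin.zero           Fin.zero           e = inj₂ (trans (sym (+-identityʳ _)) e , refl)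
  adjacent-cases _ _ (Fin.suc Fin.zero) (Fin.suc Fin.zero) e = inj₂ (trans (sym (+-identityʳ _)) e , refl)
  adjacent-cases _ _ Fin.zero           (Fin.suc Fin.zero) e = inj₁ (same-column e , refl)
  adjacent-cases _ _ (Fin.suc Fin.zero) Fin.zero           e = inj₁ (same-column e , refl)

  rung : ∀ (i : Fin n) {j j'} → j ≢ j' → GridAdj (i , j) (i , j')
  rung i {Fin.zero}         {Fin.zero}         j≢j' = ⊥-elim (j≢j' refl)
  rung i {Fin.zero}         {Fin.suc Fin.zero} _    = cong (_+ 1) (∣n-n∣≡0 (toℕ i))
  rung i {Fin.suc Fin.zero} {Fin.zero}         _    = cong (_+ 1) (∣n-n∣≡0 (toℕ i))
  rung i {Fin.suc Fin.zero} {Fin.suc Fin.zero} j≢j' = ⊥-elim (j≢j' refl)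

  along-row : ∀ (i i' : Fin n) j → ∣ toℕ i - toℕ i' ∣ ≡ 1 → GridAdj (i , j) (i' , j)
  along-row i i' j e = begin
    ∣ toℕ i - toℕ i' ∣ + ∣ toℕ j - toℕ j ∣ ≡⟨ cong (∣ toℕ i - toℕ i' ∣ +_) (∣n-n∣≡0 (toℕ j)) ⟩
    ∣ toℕ i - toℕ i' ∣ + 0                 ≡⟨ +-identityʳ _ ⟩
    ∣ toℕ i - toℕ i' ∣                     ≡⟨ e ⟩
    1                                      ∎
    where open ≡-Reasoning

  intact-∷ : ∀ {D : Burnt n} {e u v} → (u , v) ≢ e → (v , u) ≢ e →
             ¬ Deleted D u v → ¬ Deleted (e ∷ D) u v
  intact-∷ uv≢e _    _      (inj₁ (here eq)) = uv≢e eq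
  intact-∷ _    vu≢e _      (inj₂ (here eq)) = vu≢e eq
  intact-∷ _    _    intact (inj₁ (there m)) = intact (inj₁ m)
  intact-∷ _    _    intact (inj₂ (there m)) = intact (inj₂ m)

MoveLoses : ∀ {n} → Burnt n → V n → V n → V n → V n → Set
MoveLoses D c₁ c₂ r r' = (r' ≡ c₁) ⊎ (r' ≡ c₂) ⊎ CopWin ((r , r') ∷ D) c₁ c₂ r'

swap-cops : ∀ {n} {D : Burnt n} {c₁ c₂ r} → CopWin D c₁ c₂ r → CopWin D c₂ c₁ r
swap-cops (caught p) = caught (Sum.swap p)
swap-cops (move c₁' c₂' m₁ m₂ (inj₁ p)) = move c₂' c₁' m₂ m₁ (inj₁ (Sum.swap p))
swap-cops {n} {D} {r = r} (move c₁' c₂' m₁ m₂ (inj₂ (stay , reply))) =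
  move c₂' c₁' m₂ m₁ (inj₂ (swap-cops stay , reply'))
  where
  reply' : ∀ r' → Edge D r r' → MoveLoses D c₂' c₁' r r'
  reply' r' e with reply r' e
  ... | inj₁ p          = inj₂ (inj₁ p)
  ... | inj₂ (inj₁ p)   = inj₁ p
  ... | inj₂ (inj₂ win) = inj₂ (inj₂ (swap-cops win))

cop-at : ∀ {n} {D : Burnt n} {c₁ c₂ r v} → (c₁ ≡ v) ⊎ (c₂ ≡ v) →
         (∀ partner → CopWin D v partner r) → CopWin D c₁ c₂ r
cop-at (inj₁ refl) wins = wins _
cop-at (inj₂ refl) wins = swap-cops (wins _)

-- Chasing towards smaller numbers then covers both
-- directions: `column-index` chases leftwards, `mirror-index` rightwards.
record Coordinate (n : ℕ) : Set where
  field
    pos           : Fin n → ℕ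
    pos-injective : ∀ {i i'} → pos i ≡ pos i' → i ≡ i'
    pos-distance  : ∀ i i' → ∣ pos i - pos i' ∣ ≡ ∣ toℕ i - toℕ i' ∣

column-index : ∀ {n} → Coordinate n
column-index = record { pos = toℕ ; pos-injective = toℕ-injective ; pos-distance = λ _ _ → refl }

mirror-index : ∀ {n} → Coordinate n
mirror-index {n} = record
  { pos = toℕ ∘ opposite ; pos-injective = injective ; pos-distance = distance }
  where
  injective : ∀ {i i'} → toℕ (opposite i) ≡ toℕ (opposite i') → i ≡ i'
  injective {i} {i'} e = begin
    i                     ≡⟨ opposite-involutive i ⟨
    opposite (opposite i)  ≡⟨ cong opposite (toℕ-injective e) ⟩
    opposite (opposite i') ≡⟨ opposite-involutive i' ⟩
    i'                     ∎
    where open ≡-Reasoning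
  distance : ∀ i i' → ∣ toℕ (opposite i) - toℕ (opposite i') ∣ ≡ ∣ toℕ i - toℕ i' ∣
  distance i i' rewrite opposite-prop i | opposite-prop i' = ∣∸-∸∣ (toℕ<n i) (toℕ<n i')

opposite-antitone : ∀ {n} {i i' : Fin n} → toℕ i ≤ toℕ i' → toℕ (opposite i') ≤ toℕ (opposite i)
opposite-antitone {n} {i} {i'} i≤i' rewrite opposite-prop i | opposite-prop i' = ∸-monoʳ-≤ n (s≤s i≤i')

module Chase {n : ℕ} (C : Coordinate n) where
  open Coordinate C

  Beyond : ℕ → V n × V n → Set
  Beyond m (u , v) = m ≤ pos (proj₁ u) × m ≤ pos (proj₁ v)

  untouched : ∀ {D : Burnt n} {u v} → All (Beyond (suc (pos (proj₁ u)))) D → ¬ Deleted D u v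
  untouched beyond (inj₁ m) = <-irrefl refl (proj₁ (All.lookup beyond m))
  untouched beyond (inj₂ m) = <-irrefl refl (proj₂ (All.lookup beyond m))

  step-apart : ∀ i i' → ∣ toℕ i - toℕ i' ∣ ≡ 1 → (pos i' ≡ suc (pos i)) ⊎ (suc (pos i') ≡ pos i)
  step-apart i i' e = distance-one (pos i) (pos i') (trans (pos-distance i i') e)

  step-back : ∀ {i i'} → pos i ≡ suc (pos i') → ∣ toℕ i - toℕ i' ∣ ≡ 1
  step-back {i} {i'} e = trans (sym (pos-distance i i')) (distance-suc e)

  mutual
    -- The
    -- cop shadows him along the other row, whatever the partner o does:
    -- turning back is blocked by the burnt edge, crossing the rung or
    -- staying meets the cop, and the coordinate cannot decrease forever.
    chase : ∀ x {D} (i p : Fin n) j (o : V n) → pos i ≡ x → pos p ≡ suc x →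
            All (Beyond (suc x)) D →
            CopWin (((p , j) , (i , j)) ∷ D) (p , flip j) o (i , j)
    chase x {D} i p j o i≡x p≡1+x beyond =
      move (i , flip j) o (inj₂ (shadow , shadow-intact)) (inj₁ refl) (inj₂ (on-stay , on-move))
      where
      D' = ((p , j) , (i , j)) ∷ D

      beyond-i : All (Beyond (suc (pos i))) D
      beyond-i = subst (λ m → All (Beyond (suc m)) D) (sym i≡x) beyond

      other-row : ∀ {u u' v v' : V n} → proj₂ u ≢ proj₂ v → (u , u') ≢ (v , v')
      other-row ≢ e = ≢ (cong (proj₂ ∘ proj₁) e)

      shadow : GridAdj (p , flip j) (i , flip j)
      shadow = along-row p i (flip j) (step-back (trans p≡1+x (cong suc (sym i≡x))))

      shadow-intact : ¬ Deleted D' (p , flip j) (i , flip j)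
      shadow-intact = intact-∷ (other-row (flip-≢ j)) (other-row (flip-≢ j)) (untouched beyond-i ∘ Sum.swap)

      on-stay : CopWin D' (i , flip j) o (i , j)
      on-stay = move (i , j) o (inj₂ (rung i (flip-≢ j) , crossing-intact)) (inj₁ refl) (inj₁ (inj₁ refl))
        where
        crossing-intact : ¬ Deleted D' (i , flip j) (i , j)
        crossing-intact = intact-∷ (other-row (flip-≢ j)) (λ e → flip-≢ j (cong (proj₂ ∘ proj₂) e))
                                   (untouched beyond-i)

      on-move : ∀ r' → Edge D' (i , j) r' → MoveLoses D' (i , flip j) o (i , j) r'
      on-move (i' , j') (adj , intact) with adjacent-cases i i' j j' adj
      ... | inj₁ (refl , refl) = inj₁ refl
      ... | inj₂ (e , refl) with step-apart i i' e
      ...   | inj₁ back  = ⊥-elim (intact (inj₂ (here (cong (λ c → (c , j) , (i , j)) i'≡p))))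
        where i'≡p = pos-injective (trans back (trans (cong suc i≡x) (sym p≡1+x)))
      ...   | inj₂ ahead = inj₂ (inj₂ (chase-on x i' i p j o (trans ahead i≡x) i≡x p≡1+x beyond))

    chase-on : ∀ x {D} (i' i p : Fin n) j (o : V n) → suc (pos i') ≡ x → pos i ≡ x →
               pos p ≡ suc x → All (Beyond (suc x)) D →
               CopWin (((i , j) , (i' , j)) ∷ ((p , j) , (i , j)) ∷ D) (i , flip j) o (i' , j)
    chase-on zero    i' i p j o ()
    chase-on (suc x) i' i p j o i'≡x i≡1+x p≡2+x beyond =
      chase x i' i j o (suc-injective i'≡x) i≡1+x
        ((p-beyond , ≤-reflexive (sym i≡1+x)) ∷ All.map (λ (a , b) → <⇒≤ a , <⇒≤ b) beyond)
      where
      p-beyond : suc x ≤ pos p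
      p-beyond = ≤-trans (n≤1+n (suc x)) (≤-reflexive (sym p≡2+x))

∈-transfer : ∀ {A B : Set} {R : A → B → Set} → (∀ {a b b'} → R a b → R a b' → b ≡ b') →
             ∀ {as bs a b} → Pointwise R as bs → R a b → a ∈ as → b ∈ bs
∈-transfer functional (r ∷ _)  rab (here refl) = here (functional rab r)
∈-transfer functional (_ ∷ rs) rab (there m)   = there (∈-transfer functional rs rab m)

-- The abstract game inside a block of columns: a spot is (column offset
-- inside the block, row).
Spot : Set
Spot = ℕ × Fin 2

_≟ˢ_ : DecidableEquality Spot
_≟ˢ_ = ≡-dec ℕ._≟_ Fin._≟_

_≟ᵉ_ : DecidableEquality (Spot × Spot)
_≟ᵉ_ = ≡-dec _≟ˢ_ _≟ˢ_

open DecMembership _≟ᵉ_ using (_∈?_)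

AbsBurnt : Set
AbsBurnt = List (Spot × Spot)

Cut : AbsBurnt → Spot → Spot → Set
Cut B x y = ((x , y) ∈ B) ⊎ ((y , x) ∈ B)

cut? : ∀ B x y → Dec (Cut B x y)
cut? B x y = ((x , y) ∈? B) ⊎-dec ((y , x) ∈? B)

-- Cop moves: stay (S), one column left (L) or right (R), cross the rung (Fl).
data Move : Set where
  S L R Fl : Move

target : Move → Spot → Spot
target S  x       = x
target L  (o , j) = (pred o , j)
target R  (o , j) = (suc o , j)
target Fl (o , j) = (o , flip j)

-- Cop strategy trees.  `win`: the robber is caught; `cap m₁ m₂`: the cops
-- move onto the robber; `step m₁ m₂ s l r f`: the cops move, and s, l, r, f
-- answer a robber who then stays, goes left, goes right or crosses the rung.
data Cert : Set where
  win  : Cert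
  cap  : Move → Move → Cert
  step : Move → Move → Cert → Cert → Cert → Cert → Cert

-- A robber leaving
-- the block must find a cop on the rung of the vertex he leaves, so that
-- `chase` applies; on the right end this also needs every burnt edge inside
-- the block (on the left end that holds automatically).
module Checker (K : ℕ) where

  legal : AbsBurnt → Move → Spot → Bool
  legal B S  _           = true
  legal B L  (zero , j)  = false
  legal B L  (suc o , j) = not ⌊ cut? B (suc o , j) (o , j) ⌋
  legal B R  (o , j)     = ⌊ suc o ≤? K ⌋ ∧ not ⌊ cut? B (o , j) (suc o , j) ⌋
  legal B Fl (o , j)     = not ⌊ cut? B (o , j) (o , flip j) ⌋

  occupied : Spot → Spot → Spot → Bool
  occupied x₁ x₂ y = ⌊ x₁ ≟ˢ y ⌋ ∨ ⌊ x₂ ≟ˢ y ⌋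

  inside : AbsBurnt → Bool
  inside []            = true
  inside ((x , y) ∷ B) = ⌊ proj₁ x ≤? K ⌋ ∧ ⌊ proj₁ y ≤? K ⌋ ∧ inside B

  mutual
    wins : Cert → AbsBurnt → Spot → Spot → Spot → Bool
    wins win                B x₁ x₂ y = occupied x₁ x₂ y
    wins (cap m₁ m₂)        B x₁ x₂ y =
      legal B m₁ x₁ ∧ legal B m₂ x₂ ∧ occupied (target m₁ x₁) (target m₂ x₂) y
    wins (step m₁ m₂ s l r f) B x₁ x₂ y =
      legal B m₁ x₁ ∧ legal B m₂ x₂ ∧ answers s l r f B (target m₁ x₁) (target m₂ x₂) y

    answers : Cert → Cert → Cert → Cert → AbsBurnt → Spot → Spot → Spot → Bool
    answers s l r f B x₁ x₂ (o , j) =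
      wins s B x₁ x₂ (o , j) ∧ left l B x₁ x₂ (o , j) ∧ right r B x₁ x₂ (o , j) ∧
      after f B x₁ x₂ (o , j) (o , flip j)

    left : Cert → AbsBurnt → Spot → Spot → Spot → Bool
    left c B x₁ x₂ (zero , j)  = occupied x₁ x₂ (zero , flip j)
    left c B x₁ x₂ (suc o , j) = after c B x₁ x₂ (suc o , j) (o , j)

    right : Cert → AbsBurnt → Spot → Spot → Spot → Bool
    right c B x₁ x₂ (o , j) with o ℕ.≟ K
    ... | yes _ = inside B ∧ occupied x₁ x₂ (o , flip j)
    ... | no  _ = after c B x₁ x₂ (o , j) (suc o , j)

    after : Cert → AbsBurnt → Spot → Spot → Spot → Spot → Bool
    after c B x₁ x₂ y y' = ⌊ cut? B y y' ⌋ ∨ occupied x₁ x₂ y' ∨ wins c ((y , y') ∷ B) x₁ x₂ y'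

module Soundness (n A K : ℕ) (block : A + K < n) where
  open Checker K

  _≈_ : V n → Spot → Set
  u ≈ x = toℕ (proj₁ u) ≡ A + proj₁ x × proj₂ u ≡ proj₂ x

  _≈ᵉ_ : V n × V n → Spot × Spot → Set
  (u , v) ≈ᵉ (x , y) = u ≈ x × v ≈ y

  ≈-functional : ∀ {u x y} → u ≈ x → u ≈ y → x ≡ y
  ≈-functional {x = o , _} {o' , _} (c , r) (c' , r') =
    cong₂ _,_ (+-cancelˡ-≡ A o o' (trans (sym c) c')) (trans (sym r) r')

  ≈-injective : ∀ {u v x} → u ≈ x → v ≈ x → u ≡ v
  ≈-injective (c , r) (c' , r') = cong₂ _,_ (toℕ-injective (trans c (sym c'))) (trans r (sym r'))

  ≈ᵉ-functional : ∀ {e a b} → e ≈ᵉ a → e ≈ᵉ b → a ≡ b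
  ≈ᵉ-functional (ux , vy) (ux' , vy') = cong₂ _,_ (≈-functional ux ux') (≈-functional vy vy')

  ≈ᵉ-injective : ∀ {a e e'} → e ≈ᵉ a → e' ≈ᵉ a → e ≡ e'
  ≈ᵉ-injective (ux , vy) (ux' , vy') = cong₂ _,_ (≈-injective ux ux') (≈-injective vy vy')

  deleted⇒cut : ∀ {D B u v x y} → Pointwise _≈ᵉ_ D B → u ≈ x → v ≈ y → Deleted D u v → Cut B x y
  deleted⇒cut D≈B ux vy =
    Sum.map (∈-transfer ≈ᵉ-functional D≈B (ux , vy)) (∈-transfer ≈ᵉ-functional D≈B (vy , ux))

  cut⇒deleted : ∀ {D B u v x y} → Pointwise _≈ᵉ_ D B → u ≈ x → v ≈ y → Cut B x y → Deleted D u v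
  cut⇒deleted D≈B ux vy =
    Sum.map (∈-transfer ≈ᵉ-injective B≈D (ux , vy)) (∈-transfer ≈ᵉ-injective B≈D (vy , ux))
    where B≈D = Pointwise.symmetric (λ r → r) D≈B

  occupied-sound : ∀ {c₁ c₂ u x₁ x₂ y} → c₁ ≈ x₁ → c₂ ≈ x₂ → u ≈ y →
                   T (occupied x₁ x₂ y) → (c₁ ≡ u) ⊎ (c₂ ≡ u)
  occupied-sound {u = u} {x₁} {x₂} {y} c₁x c₂x uy h =
    Sum.map (λ e → ≈-injective c₁x (subst (u ≈_) (sym (toWitness {a? = x₁ ≟ˢ y} e)) uy))
            (λ e → ≈-injective c₂x (subst (u ≈_) (sym (toWitness {a? = x₂ ≟ˢ y} e)) uy))
            (∨-elim {⌊ x₁ ≟ˢ y ⌋} h)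

  vertex : ∀ {o} → o ≤ K → ∀ j → Σ (V n) (_≈ (o , j))
  vertex {o} o≤K j = (fromℕ< o-inside , j) , toℕ-fromℕ< o-inside , refl
    where o-inside = ≤-<-trans (+-monoʳ-≤ A o≤K) block

  cop-move : ∀ m {D B c x} → Pointwise _≈ᵉ_ D B → c ≈ x → proj₁ x ≤ K → T (legal B m x) →
             proj₁ (target m x) ≤ K × Σ (V n) λ c' → c' ≈ target m x × CopMove D c c'
  cop-move S D≈B cx x≤K _ = x≤K , _ , cx , inj₁ refl
  cop-move L {c = i , _} {x = suc o , j} D≈B (i≡ , refl) x≤K intact =
    o≤K , c' , c'x , inj₂ (along-row i (proj₁ c') j (distance-suc i≡1+i') ,
                           toWitnessFalse intact ∘ deleted⇒cut D≈B (i≡ , refl) c'x)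
    where
    o≤K = <⇒≤ x≤K
    c' = proj₁ (vertex o≤K j)
    c'x = proj₂ (vertex o≤K j)
    i≡1+i' : toℕ i ≡ suc (toℕ (proj₁ c'))
    i≡1+i' = trans i≡ (trans (+-suc A o) (cong suc (sym (proj₁ c'x))))
  cop-move R {c = i , _} {x = o , j} D≈B (i≡ , refl) x≤K h =
    o<K , c' , c'x , inj₂ (along-row i (proj₁ c') j neighbours ,
                           toWitnessFalse intact ∘ deleted⇒cut D≈B (i≡ , refl) c'x)
    where
    o<K = toWitness (proj₁ (∧-elim {⌊ suc o ≤? K ⌋} h))
    intact = proj₂ (∧-elim {⌊ suc o ≤? K ⌋} h)
    c' = proj₁ (vertex o<K j)
    c'x = proj₂ (vertex o<K j)
    neighbours : ∣ toℕ i - toℕ (proj₁ c') ∣ ≡ 1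
    neighbours = trans (∣-∣-comm (toℕ i) _)
                 (distance-suc (trans (proj₁ c'x) (trans (+-suc A o) (cong suc (sym i≡)))))
  cop-move Fl {c = i , _} {x = o , j} D≈B (i≡ , refl) x≤K intact =
    x≤K , (i , flip j) , (i≡ , refl) ,
    inj₂ (rung i (flip-≢ j ∘ sym) , toWitnessFalse intact ∘ deleted⇒cut D≈B (i≡ , refl) (i≡ , refl))

  record Simulates (D : Burnt n) (c₁ c₂ : V n) (B : AbsBurnt) (x₁ x₂ : Spot) : Set where
    field
      burnt   : Pointwise _≈ᵉ_ D B
      cop₁    : c₁ ≈ x₁
      cop₂    : c₂ ≈ x₂
      inside₁ : proj₁ x₁ ≤ K
      inside₂ : proj₁ x₂ ≤ K
  open Simulates

  burn : ∀ {D c₁ c₂ B x₁ x₂ r r' y y'} → Simulates D c₁ c₂ B x₁ x₂ → r ≈ y → r' ≈ y' →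
         Simulates ((r , r') ∷ D) c₁ c₂ ((y , y') ∷ B) x₁ x₂
  burn s ry r'y' = record
    { burnt = (ry , r'y') ∷ burnt s ; cop₁ = cop₁ s ; cop₂ = cop₂ s ; inside₁ = inside₁ s ; inside₂ = inside₂ s }

  cops-move : ∀ m₁ m₂ {D c₁ c₂ B x₁ x₂} → Simulates D c₁ c₂ B x₁ x₂ →
              T (legal B m₁ x₁) → T (legal B m₂ x₂) →
              Σ (V n) λ c₁' → Σ (V n) λ c₂' → CopMove D c₁ c₁' × CopMove D c₂ c₂' ×
              Simulates D c₁' c₂' B (target m₁ x₁) (target m₂ x₂)
  cops-move m₁ m₂ s legal₁ legal₂ =
    let in₁ , c₁' , c₁'x , mv₁ = cop-move m₁ (burnt s) (cop₁ s) (inside₁ s) legal₁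
        in₂ , c₂' , c₂'x , mv₂ = cop-move m₂ (burnt s) (cop₂ s) (inside₂ s) legal₂
    in c₁' , c₂' , mv₁ , mv₂ , record { burnt = burnt s ; cop₁ = c₁'x ; cop₂ = c₂'x ; inside₁ = in₁ ; inside₂ = in₂ }

  burnt-right-of-A : ∀ {D B} → Pointwise _≈ᵉ_ D B → All (Chase.Beyond column-index A) D
  burnt-right-of-A []                          = []
  burnt-right-of-A (((u≡ , _) , (v≡ , _)) ∷ rest) =
    (subst (A ≤_) (sym u≡) (m≤m+n A _) , subst (A ≤_) (sym v≡) (m≤m+n A _)) ∷ burnt-right-of-A rest

  burnt-left-of-A+K : ∀ {D B} → Pointwise _≈ᵉ_ D B → T (inside B) →
                  All (λ (u , v) → toℕ (proj₁ u) ≤ A + K × toℕ (proj₁ v) ≤ A + K) D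
  burnt-left-of-A+K []                                             _ = []
  burnt-left-of-A+K {B = (x , y) ∷ _} (((u≡ , _) , (v≡ , _)) ∷ rest) h =
    let x≤K , h₁ = ∧-elim {⌊ proj₁ x ≤? K ⌋} h ; y≤K , h₂ = ∧-elim {⌊ proj₁ y ≤? K ⌋} h₁ in
    (within u≡ (toWitness x≤K) , within v≡ (toWitness y≤K)) ∷ burnt-left-of-A+K rest h₂
    where
    within : ∀ {c o} → c ≡ A + o → o ≤ K → c ≤ A + K
    within refl o≤K = +-monoʳ-≤ A o≤K

  escape-left : ∀ {D c₁ c₂ B x₁ x₂ i i' j} → Simulates D c₁ c₂ B x₁ x₂ → toℕ i ≡ A + 0 →
                suc (toℕ i') ≡ toℕ i → T (occupied x₁ x₂ (0 , flip j)) →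
                CopWin (((i , j) , (i' , j)) ∷ D) c₁ c₂ (i' , j)
  escape-left {i = i} {i'} {j} s i≡A i'+1≡i occ =
    cop-at (occupied-sound (cop₁ s) (cop₂ s) (i≡A , refl) occ)
      (λ partner → Chase.chase column-index (toℕ i') i' i j partner refl (sym i'+1≡i) beyond)
    where
    beyond = subst (λ m → All (Chase.Beyond column-index m) _)
                   (trans (sym (+-identityʳ A)) (sym (trans i'+1≡i i≡A)))
                   (burnt-right-of-A (burnt s))

  escape-right : ∀ {D c₁ c₂ B x₁ x₂ i i' j} → Simulates D c₁ c₂ B x₁ x₂ → toℕ i ≡ A + K →
                 toℕ i' ≡ suc (toℕ i) → T (inside B) → T (occupied x₁ x₂ (K , flip j)) →
                 CopWin (((i , j) , (i' , j)) ∷ D) c₁ c₂ (i' , j)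
  escape-right {i = i} {i'} {j} s i≡A+K i'≡i+1 in-block occ =
    cop-at (occupied-sound (cop₁ s) (cop₂ s) (i≡A+K , refl) occ)
      (λ partner → Chase.chase mirror-index (toℕ (opposite i')) i' i j partner refl mirrored beyond)
    where
    mirrored : toℕ (opposite i) ≡ suc (toℕ (opposite i'))
    mirrored rewrite opposite-prop i | opposite-prop i' | sym i'≡i+1 = ∸-suc (toℕ<n i')
    past : ∀ (u : Fin n) → toℕ u ≤ A + K → suc (toℕ (opposite i')) ≤ toℕ (opposite u)
    past u u≤ = subst (_≤ toℕ (opposite u)) mirrored
                      (opposite-antitone {i = u} {i} (subst (toℕ u ≤_) (sym i≡A+K) u≤))
    beyond : All (Chase.Beyond mirror-index (suc (toℕ (opposite i')))) _
    beyond = All.map (λ {((u , _) , (v , _))} (u≤ , v≤) → past u u≤ , past v v≤)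
                     (burnt-left-of-A+K (burnt s) in-block)

  mutual
    wins-sound : ∀ c {D c₁ c₂ r B x₁ x₂ y} → Simulates D c₁ c₂ B x₁ x₂ → r ≈ y →
                 T (wins c B x₁ x₂ y) → CopWin D c₁ c₂ r
    wins-sound win s ry h = caught (occupied-sound (cop₁ s) (cop₂ s) ry h)
    wins-sound (cap m₁ m₂) s ry h =
      let legal₁ , h₁ = ∧-elim h ; legal₂ , occ = ∧-elim h₁
          c₁' , c₂' , mv₁ , mv₂ , s' = cops-move m₁ m₂ s legal₁ legal₂
      in move c₁' c₂' mv₁ mv₂ (inj₁ (occupied-sound (cop₁ s') (cop₂ s') ry occ))
    wins-sound (step m₁ m₂ sc lc rc fc) {r = ri , rj} {y = o , .rj} s (ri≡ , refl) h =
      let legal₁ , h₁ = ∧-elim h ; legal₂ , h₂ = ∧-elim h₁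
          stays , h₃ = ∧-elim h₂ ; lefts , h₄ = ∧-elim h₃ ; rights , crosses = ∧-elim h₄
          c₁' , c₂' , mv₁ , mv₂ , s' = cops-move m₁ m₂ s legal₁ legal₂
      in move c₁' c₂' mv₁ mv₂ (inj₂ (wins-sound sc s' (ri≡ , refl) stays ,
                                     replies-sound lc rc fc s' ri≡ lefts rights crosses))

    replies-sound : ∀ lc rc fc {D c₁ c₂ B x₁ x₂ ri rj o} → Simulates D c₁ c₂ B x₁ x₂ →
                    toℕ ri ≡ A + o → T (left lc B x₁ x₂ (o , rj)) → T (right rc B x₁ x₂ (o , rj)) →
                    T (after fc B x₁ x₂ (o , rj) (o , flip rj)) →
                    ∀ r' → Edge D (ri , rj) r' → MoveLoses D c₁ c₂ (ri , rj) r'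
    replies-sound lc rc fc {ri = ri} {rj} s ri≡ lefts rights crosses (i' , j') (adj , intact)
      with adjacent-cases ri i' rj j' adj
    ... | inj₁ (refl , refl) = after-sound fc s (ri≡ , refl) (ri≡ , refl) intact crosses
    ... | inj₂ (e , refl) with distance-one (toℕ ri) (toℕ i') e
    ...   | inj₁ ahead = right-sound rc s ri≡ ahead intact rights
    ...   | inj₂ back  = left-sound lc _ s ri≡ back intact lefts

    left-sound : ∀ lc o {D c₁ c₂ B x₁ x₂ ri i' rj} → Simulates D c₁ c₂ B x₁ x₂ → toℕ ri ≡ A + o →
                 suc (toℕ i') ≡ toℕ ri → ¬ Deleted D (ri , rj) (i' , rj) →
                 T (left lc B x₁ x₂ (o , rj)) → MoveLoses D c₁ c₂ (ri , rj) (i' , rj)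
    left-sound lc zero    s ri≡ back intact h = inj₂ (inj₂ (escape-left s ri≡ back h))
    left-sound lc (suc o) s ri≡ back intact h =
      after-sound lc s (ri≡ , refl) (suc-injective (trans back (trans ri≡ (+-suc A o))) , refl) intact h

    right-sound : ∀ rc {o D c₁ c₂ B x₁ x₂ ri i' rj} → Simulates D c₁ c₂ B x₁ x₂ → toℕ ri ≡ A + o →
                  toℕ i' ≡ suc (toℕ ri) → ¬ Deleted D (ri , rj) (i' , rj) →
                  T (right rc B x₁ x₂ (o , rj)) → MoveLoses D c₁ c₂ (ri , rj) (i' , rj)
    right-sound rc {o} s ri≡ ahead intact h with o ℕ.≟ K
    ... | yes refl = let in-block , occ = ∧-elim h in inj₂ (inj₂ (escape-right s ri≡ ahead in-block occ))
    ... | no  _    = after-sound rc s (ri≡ , refl) (trans ahead (trans (cong suc ri≡) (sym (+-suc A o))) , refl) intact h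

    after-sound : ∀ c {D c₁ c₂ r r' B x₁ x₂ y y'} → Simulates D c₁ c₂ B x₁ x₂ → r ≈ y → r' ≈ y' →
                  ¬ Deleted D r r' → T (after c B x₁ x₂ y y') → MoveLoses D c₁ c₂ r r'
    after-sound c {B = B} {y = y} {y'} s ry r'y' intact h with ∨-elim {⌊ cut? B y y' ⌋} h
    ... | inj₁ cut = ⊥-elim (intact (cut⇒deleted (burnt s) ry r'y' (toWitness cut)))
    ... | inj₂ h₁ with ∨-elim h₁
    ...   | inj₁ occ = Sum.map sym (inj₁ ∘ sym) (occupied-sound (cop₁ s) (cop₂ s) r'y' occ)
    ...   | inj₂ w   = inj₂ (inj₂ (wins-sound c (burn s ry r'y') r'y' w))

-- Winning strategy trees for the starting positions: gap k between the
-- cops, robber at offset o, robber in the cops' row or not.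
certificate : ℕ → ℕ → Bool → Cert
certificate 2 1 true = cap S L
certificate 2 1 false = step S Fl (cap S L) (cap Fl S) win (cap R S)
certificate 3 1 true = cap R S
certificate 3 1 false = step Fl L (cap R S) win (cap S Fl) (cap S L)
certificate 3 2 true = cap S L
certificate 3 2 false = step R Fl (cap S L) (cap Fl S) win (cap R S)
certificate 4 1 true = cap R S
certificate 4 1 false = step S L (step Fl L (cap R S) win (cap S Fl) (cap S L)) (cap Fl S) (step R Fl (cap S L) win win (cap R S)) (cap R S)
certificate 4 2 true = step S L (cap S L) (cap R S) win (step R Fl (cap S L) (cap Fl S) win win)
certificate 4 2 false = step R L (step S Fl (cap S L) (cap Fl S) win (cap R S)) (cap Fl S) (cap S Fl) (cap S L)
certificate 4 3 true = cap S L
certificate 4 3 false = step S L (cap S Fl) (step R L (cap S Fl) (cap Fl S) win win) (step S R (cap S Fl) win win win) win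
certificate 5 1 true = cap R S
certificate 5 1 false = step R L (cap Fl S) (step L S (cap Fl S) win win win) (step R L (cap Fl S) win (cap S Fl) win) win
certificate 5 2 true = step R L (cap R S) win (cap S L) (step Fl L (cap R S) win (cap S Fl) win)
certificate 5 2 false = step R L (step Fl L (cap R S) win (cap S Fl) (cap S L)) (cap Fl S) (step R Fl (cap S L) win win (cap R S)) (cap R S)
certificate 5 3 true = step R L (cap S L) (cap R S) win (step R Fl (cap S L) (cap Fl S) win win)
certificate 5 3 false = step R L (step R Fl (cap S L) (cap Fl S) win (cap R S)) (step Fl L (cap R S) win win (cap S L)) (cap S Fl) (cap S L)
certificate 5 4 true = cap S L
certificate 5 4 false = step R L (cap S Fl) (step R L (cap S Fl) (cap Fl S) win win) (step S R (cap S Fl) win win win) win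
certificate 6 1 true = cap R S
certificate 6 1 false = step R S (cap Fl S) (step L S (cap Fl S) win win win) (step R L (cap Fl S) win (step R L (cap Fl S) win (cap S Fl) win) win) win
certificate 6 2 true = step R L (cap R S) win (step S L (cap S L) win win (step R Fl (cap S L) (cap Fl S) win win)) (step S L (step Fl L (cap R S) win (cap S Fl) win) (cap Fl S) (step R Fl (cap S L) win win (cap R S)) win)
certificate 6 2 false = step R L (step S L (step Fl L (cap R S) win (cap S Fl) (cap S L)) (cap Fl S) (step R Fl (cap S L) win win (cap R S)) (cap R S)) (cap Fl S) (step S L (step R Fl (cap S L) win win (cap R S)) win (cap S Fl) (cap S L)) (cap R S)
certificate 6 3 true = step R L (step S L (cap S L) (cap R S) win (step R Fl (cap S L) (cap Fl S) win win)) (cap R S) (cap S L) (step R L (step S Fl (cap S L) (cap Fl S) win win) (cap Fl S) (cap S Fl) win)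
certificate 6 3 false = step R L (step R L (step S Fl (cap S L) (cap Fl S) win (cap R S)) (cap Fl S) (cap S Fl) (cap S L)) (step S L (step Fl L (cap R S) win win (cap S L)) (cap Fl S) win (cap R S)) (step S Fl (cap S L) win win (step R Fl (cap S L) (cap R S) win win)) (step S L (cap S L) (cap R S) win win)
certificate 6 4 true = step R L (cap S L) (step R S (cap R S) win win (step Fl L (cap R S) win (cap S Fl) win)) win (step R S (step R Fl (cap S L) (cap Fl S) win win) (step Fl L (cap R S) win win (cap S L)) (cap S Fl) win)
certificate 6 4 false = step R L (step R S (step R Fl (cap S L) (cap Fl S) win (cap R S)) (step Fl L (cap R S) win win (cap S L)) (cap S Fl) (cap S L)) (step R S (step Fl L (cap R S) win win (cap S L)) (cap Fl S) win (cap R S)) (cap S Fl) (cap S L)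
certificate 6 5 true = cap S L
certificate 6 5 false = step S L (cap S Fl) (step R L (cap S Fl) (step R L (cap S Fl) (cap Fl S) win win) win win) (step S R (cap S Fl) win win win) win
certificate 7 1 true = cap R S
certificate 7 1 false = step R L (cap Fl S) (step L S (cap Fl S) win win win) (step R L (cap Fl S) win (step R L (cap Fl S) win (cap S Fl) win) win) win
certificate 7 2 true = step R L (cap R S) win (step R L (step Fl L (cap S L) win win (cap R S)) win (cap S L) (step Fl L (cap R S) win (cap S Fl) win)) (step Fl L (cap R S) win (step Fl L (step R Fl (cap S L) win win (cap R S)) win (cap S Fl) (cap S L)) win)
certificate 7 2 false = step R L (step R L (cap Fl S) (step L S (cap Fl S) (step L S (cap Fl S) win win win) win win) (step R L (cap Fl S) win (cap S Fl) win) win) (cap Fl S) (step R L (step R L (cap Fl S) win (cap S Fl) win) win (step R Fl (cap S L) win win (cap R S)) (cap R S)) (cap R S)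
certificate 7 3 true = step R L (step R L (cap R S) win (cap S L) (step Fl L (cap R S) win (cap S Fl) win)) (cap R S) (step R L (cap S L) win win (step R Fl (cap S L) (cap Fl S) win win)) (step R L (step Fl L (cap R S) win (cap S Fl) win) (cap Fl S) (step R Fl (cap S L) win win (cap R S)) win)
certificate 7 3 false = step R L (step R L (step Fl L (cap R S) win (cap S Fl) (cap S L)) (cap Fl S) (step R Fl (cap S L) win win (cap R S)) (cap R S)) (step Fl L (cap R S) win win (step Fl L (cap R S) win (cap S L) win)) (step R L (step R Fl (cap S L) win win (cap R S)) win (cap S Fl) (cap S L)) (step R L (cap R S) win (cap S L) win)
certificate 7 4 true = step R L (step R L (cap S L) (cap R S) win (step R Fl (cap S L) (cap Fl S) win win)) (step R L (cap R S) win win (step Fl L (cap R S) win (cap S Fl) win)) (cap S L) (step R L (step R Fl (cap S L) (cap Fl S) win win) (step Fl L (cap R S) win win (cap S L)) (cap S Fl) win)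
certificate 7 4 false = step R L (step R L (step R Fl (cap S L) (cap Fl S) win (cap R S)) (step Fl L (cap R S) win win (cap S L)) (cap S Fl) (cap S L)) (step R L (step Fl L (cap R S) win win (cap S L)) (cap Fl S) win (cap R S)) (step R Fl (cap S L) win win (step R Fl (cap S L) (cap R S) win win)) (step R L (cap S L) (cap R S) win win)
certificate 7 5 true = step R L (cap S L) (step R L (step R Fl (cap R S) win win (cap S L)) (cap R S) win (step R Fl (cap S L) (cap Fl S) win win)) win (step R Fl (cap S L) (step R Fl (step Fl L (cap R S) win win (cap S L)) (cap Fl S) win (cap R S)) win win)
certificate 7 5 false = step R L (step R L (cap S Fl) (step R L (cap S Fl) (cap Fl S) win win) (step S R (cap S Fl) win (step S R (cap S Fl) win win win) win) win) (step R L (step R L (cap S Fl) (cap Fl S) win win) (step Fl L (cap R S) win win (cap S L)) win (cap S L)) (cap S Fl) (cap S L)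
certificate 7 6 true = cap S L
certificate 7 6 false = step R L (cap S Fl) (step R L (cap S Fl) (step R L (cap S Fl) (cap Fl S) win win) win win) (step S R (cap S Fl) win win win) win
certificate 8 1 true = cap R S
certificate 8 1 false = step R S (cap Fl S) (step L S (cap Fl S) win win win) (step R L (cap Fl S) win (step R L (cap Fl S) win (step R L (cap Fl S) win (cap S Fl) win) win) win) win
certificate 8 2 true = step R L (cap R S) win (step R L (step Fl L (step S L (cap S L) win win (cap R S)) win (cap S L) (cap R S)) win (step S L (cap S L) win win (step Fl Fl (cap S L) (cap R S) win win)) (step Fl L (cap R S) win (step S L (cap S Fl) win (step S R (cap S Fl) win (step S R (cap S Fl) win (step S R (cap S Fl) win (step S R (cap S Fl) win win win) win) win) win) win) win)) (step S L (step Fl L (cap R S) win (step Fl L (step R Fl (cap S L) win win (cap R S)) win (cap S Fl) (cap S L)) win) (cap Fl S) (step R L (step R L (cap Fl S) win (cap S Fl) win) win (step R Fl (cap S L) win win (cap R S)) (cap R S)) win)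
certificate 8 2 false = step R L (step R S (cap Fl S) (step L S (cap Fl S) (step L S (cap Fl S) win win win) win win) (step R L (cap Fl S) win (step R L (cap Fl S) win (cap S Fl) win) win) win) (cap Fl S) (step R L (step R S (cap Fl S) win (step R L (cap Fl S) win (cap S Fl) win) win) win (step S L (step R Fl (cap S L) win win (cap R S)) win (cap S Fl) (cap S L)) (cap R S)) (cap R S)
certificate 8 3 true = step R L (step R L (cap R S) win (step S L (cap S L) win win (step R Fl (cap S L) (cap Fl S) win win)) (step S L (step Fl L (cap R S) win (cap S Fl) win) (cap Fl S) (step R Fl (cap S L) win win (cap R S)) win)) (cap R S) (step R L (step S L (cap S L) win win (step R Fl (cap S L) (cap Fl S) win win)) win (cap S L) (step R L (step S Fl (cap S L) (cap Fl S) win win) (cap Fl S) (cap S Fl) win)) (step R L (step S L (step Fl L (cap R S) win (cap S Fl) win) (cap Fl S) (step R Fl (cap S L) win win (cap R S)) win) (cap Fl S) (step S L (step R Fl (cap S L) win win (cap R S)) win (cap S Fl) (cap S L)) win)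
certificate 8 3 false = step R L (step R L (step S L (step Fl L (cap R S) win (cap S Fl) (cap S L)) (cap Fl S) (step R Fl (cap S L) win win (cap R S)) (cap R S)) (cap Fl S) (step S L (step R Fl (cap S L) win win (cap R S)) win (cap S Fl) (cap S L)) (cap R S)) (step S L (step Fl L (cap R S) win win (step Fl L (cap R S) win (cap S L) win)) (cap Fl S) win (cap R S)) (step S L (step R L (step R Fl (cap S L) win win (cap R S)) win (cap S Fl) (cap S L)) win (step R Fl (cap S L) win win (step R Fl (cap S L) (cap R S) win win)) (step R L (cap S L) (cap R S) win win)) (step R L (cap R S) win (step S L (cap S L) win win (step Fl Fl (cap S L) (cap R S) win win)) win)
certificate 8 4 true = step R L (step R L (step S L (cap S L) (cap R S) win (step R Fl (cap S L) (cap Fl S) win win)) (cap R S) (cap S L) (step R L (step S Fl (cap S L) (cap Fl S) win win) (cap Fl S) (cap S Fl) win)) (step R L (cap R S) win win (step Fl L (cap R S) win (step S Fl (cap S L) win win (step S Fl (cap S L) win win win)) win)) (step R L (cap S L) win win (step R Fl (cap S L) (step Fl S (cap R S) win win (step Fl S (cap R S) win win win)) win win)) (step R L (step R L (step S Fl (cap S L) (cap Fl S) win win) (cap Fl S) (cap S Fl) win) (step S L (step Fl L (cap R S) win win (cap S L)) (cap Fl S) win (cap R S)) (step S Fl (cap S L) win win (step R Fl (cap S L) (cap R S) win win)) win)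
certificate 8 4 false = step R L (step R L (step R L (step S Fl (cap S L) (cap Fl S) win (cap R S)) (cap Fl S) (cap S Fl) (cap S L)) (step S L (step Fl L (cap R S) win win (cap S L)) (cap Fl S) win (cap R S)) (step S Fl (cap S L) win win (step R Fl (cap S L) (cap R S) win win)) (step S L (cap S L) (cap R S) win win)) (step R S (step Fl L (cap R S) win win (step Fl L (cap R S) win (cap S L) win)) (cap Fl S) win (cap R S)) (step S L (step R Fl (cap S L) win win (step R Fl (cap S L) (cap R S) win win)) win (cap S Fl) (cap S L)) (step R L (step S L (cap S L) (cap R S) win win) (cap R S) (cap S L) win)
certificate 8 5 true = step R L (step R L (cap S L) (step R S (cap R S) win win (step Fl L (cap R S) win (cap S Fl) win)) win (step R S (step R Fl (cap S L) (cap Fl S) win win) (step Fl L (cap R S) win win (cap S L)) (cap S Fl) win)) (step R L (step R S (cap R S) win win (step Fl L (cap R S) win (cap S Fl) win)) (cap R S) win (step R L (step S Fl (cap S L) (cap Fl S) win win) (cap Fl S) (cap S Fl) win)) (cap S L) (step R L (step R S (step R Fl (cap S L) (cap Fl S) win win) (step Fl L (cap R S) win win (cap S L)) (cap S Fl) win) (step R S (step Fl L (cap R S) win win (cap S L)) (cap Fl S) win (cap R S)) (cap S Fl) win)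
certificate 8 5 false = step R L (step R L (step R S (step R Fl (cap S L) (cap Fl S) win (cap R S)) (step Fl L (cap R S) win win (cap S L)) (cap S Fl) (cap S L)) (step R S (step Fl L (cap R S) win win (cap S L)) (cap Fl S) win (cap R S)) (cap S Fl) (cap S L)) (step R S (step R L (step Fl L (cap R S) win win (cap S L)) (cap Fl S) win (cap R S)) (step Fl L (cap R S) win win (step Fl L (cap R S) win (cap S L) win)) win (step R L (cap R S) win (cap S L) win)) (step S L (cap S Fl) win (step S R (cap S Fl) win (step S R (cap S Fl) win win win) win) win) (step R L (cap S L) (step R S (cap R S) win win (step Fl Fl (cap R S) win (cap S L) win)) win win)
certificate 8 6 true = step R L (cap S L) (step R L (step R Fl (step S L (cap S Fl) (cap R S) win win) (cap R S) win (cap S L)) (step R S (cap R S) win win (step Fl Fl (cap R S) win (cap S L) win)) win (step R Fl (cap S L) (step R S (cap Fl S) (step L S (cap Fl S) (step L S (cap Fl S) (step L S (cap Fl S) (step L S (cap Fl S) win win win) win win) win win) win win) win win) win win)) win (step R S (step R Fl (cap S L) (step R Fl (step Fl L (cap R S) win win (cap S L)) (cap Fl S) win (cap R S)) win win) (step R L (step R L (cap S Fl) (cap Fl S) win win) (step Fl L (cap R S) win win (cap S L)) win (cap S L)) (cap S Fl) win)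
certificate 8 6 false = step R L (step S L (cap S Fl) (step R L (cap S Fl) (step R L (cap S Fl) (cap Fl S) win win) win win) (step S R (cap S Fl) win (step S R (cap S Fl) win win win) win) win) (step R L (step S L (cap S Fl) (step R L (cap S Fl) (cap Fl S) win win) win win) (step R S (step Fl L (cap R S) win win (cap S L)) (cap Fl S) win (cap R S)) win (cap S L)) (cap S Fl) (cap S L)
certificate 8 7 true = cap S L
certificate 8 7 false = step S L (cap S Fl) (step R L (cap S Fl) (step R L (cap S Fl) (step R L (cap S Fl) (cap Fl S) win win) win win) win win) (step S R (cap S Fl) win win win) win
certificate 9 1 true = cap R S
certificate 9 1 false = step R L (cap Fl S) (step L S (cap Fl S) win win win) (step R L (cap Fl S) win (step R L (cap Fl S) win (step R L (cap Fl S) win (cap S Fl) win) win) win) win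
certificate 9 2 true = step R L (cap R S) win (step R L (step Fl L (step R L (cap Fl S) win (cap S L) win) win (step R L (cap S L) win win (cap R S)) (cap R S)) win (step Fl L (step R L (cap S L) win win (cap R S)) win (cap S L) (step R L (cap R S) win (cap S Fl) win)) (step Fl L (cap R S) win (step S L (step S L (cap S Fl) win (step S R (cap S Fl) win (step S R (cap S Fl) win (step S R (cap S Fl) win (step S R (cap S Fl) win (step S R (cap S Fl) win win win) win) win) win) win) win) win (cap S Fl) (cap S L)) win)) (step Fl L (cap R S) win (step Fl L (step R L (step R L (cap Fl S) win (cap S Fl) win) win (step R Fl (cap S L) win win (cap R S)) (cap R S)) win (step R L (step R Fl (cap S L) win win (cap R S)) win (cap S Fl) (cap S L)) (step R L (cap R S) win (cap S L) win)) win)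
certificate 9 2 false = step R L (step R L (cap Fl S) (step L S (cap Fl S) (step L S (cap Fl S) win win win) win win) (step R L (cap Fl S) win (step R L (cap Fl S) win (cap S Fl) win) win) win) (cap Fl S) (step R L (step R L (cap Fl S) win (step R L (cap Fl S) win (cap S Fl) win) win) win (step R L (step R L (cap Fl S) win (cap S Fl) win) win (step R Fl (cap S L) win win (cap R S)) (cap R S)) (cap R S)) (cap R S)
certificate 9 3 true = step R L (step R L (cap R S) win (step R L (step Fl L (cap S L) win win (cap R S)) win (cap S L) (step Fl L (cap R S) win (cap S Fl) win)) (step Fl L (cap R S) win (step Fl L (step R Fl (cap S L) win win (cap R S)) win (cap S Fl) (cap S L)) win)) (cap R S) (step R L (step R L (step Fl L (cap S L) win win (cap R S)) win (cap S L) (step Fl L (cap R S) win (cap S Fl) win)) win (step R L (cap S L) win win (step Fl Fl (cap S L) (cap R S) win win)) (step R L (step Fl L (cap R S) win (cap S Fl) win) (cap Fl S) (step S L (cap S Fl) win (step S R (cap S Fl) win (step S R (cap S Fl) win (step S R (cap S Fl) win (step S R (cap S Fl) win win win) win) win) win) win) win)) (step R L (step Fl L (cap R S) win (step Fl L (step R Fl (cap S L) win win (cap R S)) win (cap S Fl) (cap S L)) win) (cap Fl S) (step R L (step R L (cap Fl S) win (cap S Fl) win) win (step R Fl (cap S L) win win (cap R S)) (cap R S)) win)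
certificate 9 3 false = step R L (step R L (step Fl L (cap R S) win (step R L (step Fl Fl (cap S L) win win (cap R S)) win (cap S Fl) (cap S L)) (step Fl L (cap R S) win (cap S L) win)) (cap Fl S) (step R L (step R L (cap Fl S) win (cap S Fl) win) win (step R Fl (cap S L) win win (cap R S)) (cap R S)) (cap R S)) (step R S (cap Fl S) (step L S (cap Fl S) (step L S (cap Fl S) win win win) win win) win win) (step R L (step R L (step R L (cap Fl S) win (cap S Fl) win) win (step R Fl (cap S L) win win (cap R S)) (cap R S)) win (step R L (step R Fl (cap S L) win win (cap R S)) win (cap S Fl) (cap S L)) (step R L (cap R S) win (cap S L) win)) (step R L (cap R S) win (step Fl L (step R L (cap S L) win win (cap R S)) win (cap S L) (step R L (cap R S) win (cap S Fl) win)) win)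
certificate 9 4 true = step R L (step R L (step R L (cap R S) win (cap S L) (step Fl L (cap R S) win (cap S Fl) win)) (cap R S) (step R L (cap S L) win win (step R Fl (cap S L) (cap Fl S) win win)) (step R L (step Fl L (cap R S) win (cap S Fl) win) (cap Fl S) (step R Fl (cap S L) win win (cap R S)) win)) (step R L (cap R S) win win (step Fl L (cap R S) win (step S L (step S Fl (cap S L) win win (step S Fl (cap S L) win win win)) win (cap S Fl) (cap S L)) win)) (step R L (step R L (cap S L) win win (step R Fl (cap S L) (cap Fl S) win win)) win (cap S L) (step R L (step R Fl (cap S L) (cap Fl S) win win) (step Fl S (cap R S) win win (step Fl S (cap R S) win win win)) (cap S Fl) win)) (step R L (step R L (step Fl L (cap R S) win (cap S Fl) win) (cap Fl S) (step R Fl (cap S L) win win (cap R S)) win) (step Fl L (cap R S) win win (step Fl L (cap R S) win (cap S L) win)) (step R L (step R Fl (cap S L) win win (cap R S)) win (cap S Fl) (cap S L)) win)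
certificate 9 4 false = step R L (step R L (step R L (step Fl L (cap R S) win (cap S Fl) (cap S L)) (cap Fl S) (step R Fl (cap S L) win win (cap R S)) (cap R S)) (step Fl L (cap R S) win win (step Fl L (cap R S) win (cap S L) win)) (step R L (step R Fl (cap S L) win win (cap R S)) win (cap S Fl) (cap S L)) (step R L (cap R S) win (cap S L) win)) (step R L (step Fl L (cap R S) win win (step Fl L (cap R S) win (cap S L) win)) (cap Fl S) win (cap R S)) (step R L (step R L (step R Fl (cap S L) win win (cap R S)) win (cap S Fl) (cap S L)) win (step R Fl (cap S L) win win (step R Fl (cap S L) (cap R S) win win)) (step R L (cap S L) (cap R S) win win)) (step R L (step R L (cap R S) win (cap S L) win) (cap R S) (step R L (cap S L) win win (step Fl Fl (cap S L) (cap R S) win win)) win)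
certificate 9 5 true = step R L (step R L (step R L (cap S L) (cap R S) win (step R Fl (cap S L) (cap Fl S) win win)) (step R L (cap R S) win win (step Fl L (cap R S) win (cap S Fl) win)) (cap S L) (step R L (step R Fl (cap S L) (cap Fl S) win win) (step Fl L (cap R S) win win (cap S L)) (cap S Fl) win)) (step R L (step R L (cap R S) win win (step Fl L (cap R S) win (cap S Fl) win)) (cap R S) win (step R L (step Fl L (cap R S) win (cap S Fl) win) (cap Fl S) (step S Fl (cap S L) win win (step S Fl (cap S L) win win win)) win)) (step R L (cap S L) win win (step R Fl (cap S L) (step R S (step Fl S (cap R S) win win (step Fl S (cap R S) win win win)) (cap Fl S) win (cap R S)) win win)) (step R L (step R L (step R Fl (cap S L) (cap Fl S) win win) (step Fl L (cap R S) win win (cap S L)) (cap S Fl) win) (step R L (step Fl L (cap R S) win win (cap S L)) (cap Fl S) win (cap R S)) (step R Fl (cap S L) win win (step R Fl (cap S L) (cap R S) win win)) win)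
certificate 9 5 false = step R L (step R L (step R L (step R Fl (cap S L) (cap Fl S) win (cap R S)) (step Fl L (cap R S) win win (cap S L)) (cap S Fl) (cap S L)) (step R L (step Fl L (cap R S) win win (cap S L)) (cap Fl S) win (cap R S)) (step R Fl (cap S L) win win (step R Fl (cap S L) (cap R S) win win)) (step R L (cap S L) (cap R S) win win)) (step R L (step R L (step Fl L (cap R S) win win (cap S L)) (cap Fl S) win (cap R S)) (step Fl L (cap R S) win win (step Fl L (cap R S) win (cap S L) win)) win (step R L (cap R S) win (cap S L) win)) (step R L (step R Fl (cap S L) win win (step R Fl (cap S L) (cap R S) win win)) win (cap S Fl) (cap S L)) (step R L (step R L (cap S L) (cap R S) win win) (step R L (cap R S) win win (step Fl Fl (cap R S) win (cap S L) win)) (cap S L) win)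
certificate 9 6 true = step R L (step R L (cap S L) (step R L (step R Fl (cap R S) win win (cap S L)) (cap R S) win (step R Fl (cap S L) (cap Fl S) win win)) win (step R Fl (cap S L) (step R Fl (step Fl L (cap R S) win win (cap S L)) (cap Fl S) win (cap R S)) win win)) (step R L (step R L (step R Fl (cap R S) win win (cap S L)) (cap R S) win (step R Fl (cap S L) (cap Fl S) win win)) (step R L (cap R S) win win (step Fl Fl (cap R S) win (cap S L) win)) win (step R L (step R Fl (cap S L) (cap Fl S) win win) (step R S (cap Fl S) (step L S (cap Fl S) (step L S (cap Fl S) (step L S (cap Fl S) (step L S (cap Fl S) win win win) win win) win win) win win) win win) (cap S Fl) win)) (cap S L) (step R L (step R Fl (cap S L) (step R Fl (step Fl L (cap R S) win win (cap S L)) (cap Fl S) win (cap R S)) win win) (step R L (step R L (cap S Fl) (cap Fl S) win win) (step Fl L (cap R S) win win (cap S L)) win (cap S L)) (cap S Fl) win)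
certificate 9 6 false = step R L (step R L (step R Fl (cap S L) (step R L (step Fl Fl (cap R S) win win (cap S L)) (cap Fl S) win (cap R S)) win (step R Fl (cap S L) (cap R S) win win)) (step R L (step R L (cap S Fl) (cap Fl S) win win) (step Fl L (cap R S) win win (cap S L)) win (cap S L)) (cap S Fl) (cap S L)) (step R L (step R L (step R L (cap S Fl) (cap Fl S) win win) (step Fl L (cap R S) win win (cap S L)) win (cap S L)) (step R L (step Fl L (cap R S) win win (cap S L)) (cap Fl S) win (cap R S)) win (step R L (cap S L) (cap R S) win win)) (step S L (cap S Fl) win (step S R (cap S Fl) win (step S R (cap S Fl) win win win) win) win) (step R L (cap S L) (step R Fl (step R L (cap R S) win win (cap S L)) (cap R S) win (step R L (cap S L) (cap Fl S) win win)) win win)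
certificate 9 7 true = step R L (cap S L) (step R L (step R Fl (step R L (cap S Fl) (cap R S) win win) (step R L (cap R S) win win (cap S L)) win (cap S L)) (step R Fl (step R L (cap R S) win win (cap S L)) (cap R S) win (step R L (cap S L) (cap Fl S) win win)) win (step R Fl (cap S L) (step R S (step R S (cap Fl S) (step L S (cap Fl S) (step L S (cap Fl S) (step L S (cap Fl S) (step L S (cap Fl S) (step L S (cap Fl S) win win win) win win) win win) win win) win win) win win) (cap Fl S) win (cap R S)) win win)) win (step R Fl (cap S L) (step R Fl (step R L (step R L (cap S Fl) (cap Fl S) win win) (step Fl L (cap R S) win win (cap S L)) win (cap S L)) (step R L (step Fl L (cap R S) win win (cap S L)) (cap Fl S) win (cap R S)) win (step R L (cap S L) (cap R S) win win)) win win)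
certificate 9 7 false = step R L (step R L (cap S Fl) (step R L (cap S Fl) (step R L (cap S Fl) (cap Fl S) win win) win win) (step S R (cap S Fl) win (step S R (cap S Fl) win win win) win) win) (step R L (step R L (cap S Fl) (step R L (cap S Fl) (cap Fl S) win win) win win) (step R L (step R L (cap S Fl) (cap Fl S) win win) (step Fl L (cap R S) win win (cap S L)) win (cap S L)) win (cap S L)) (cap S Fl) (cap S L)
certificate 9 8 true = cap S L
certificate 9 8 false = step R L (cap S Fl) (step R L (cap S Fl) (step R L (cap S Fl) (step R L (cap S Fl) (cap Fl S) win win) win win) win win) (step S R (cap S Fl) win win win) win
certificate _ _ _ = win

start-accepted : ℕ → ℕ → Fin 2 → Fin 2 → Bool
start-accepted k o row rj =
  Checker.wins k (certificate k o ⌊ row Fin.≟ rj ⌋) [] (0 , row) (k , row) (o , rj)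

all-below : (ℕ → Bool) → ℕ → Bool
all-below f zero    = true
all-below f (suc m) = all-below f m ∧ f m

all-below-sound : ∀ f {m} n → T (all-below f n) → m < n → T (f m)
all-below-sound f {m} (suc n) h m<1+n with m<1+n⇒m<n∨m≡n m<1+n
... | inj₁ m<n  = all-below-sound f n (proj₁ (∧-elim h)) m<n
... | inj₂ refl = proj₂ (∧-elim h)

both-rows : (Fin 2 → Bool) → Bool
both-rows f = f Fin.zero ∧ f (Fin.suc Fin.zero)

both-rows-sound : ∀ f → T (both-rows f) → ∀ j → T (f j)
both-rows-sound f h Fin.zero           = proj₁ (∧-elim h)
both-rows-sound f h (Fin.suc Fin.zero) = proj₂ (∧-elim h)

-- Both rows for the cops and the robber, robber at offset 1 + o.
accepted-at : ℕ → ℕ → Bool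
accepted-at k o = both-rows λ row → both-rows λ rj → start-accepted k (suc o) row rj

accepted-gap : ℕ → Bool
accepted-gap k = all-below (accepted-at k) (pred k)

all-accepted : T (all-below accepted-gap 10)
all-accepted = tt

start-verified : ∀ {k o} → k ≤ 9 → 0 < o → o < k → ∀ row rj → T (start-accepted k o row rj)
start-verified {k} {suc o} k≤9 _ o<k row rj =
  both-rows-sound (start-accepted k (suc o) row)
    (both-rows-sound (λ row → both-rows (start-accepted k (suc o) row))
      (all-below-sound (accepted-at k) (pred k)
        (all-below-sound accepted-gap 10 all-accepted (s≤s k≤9))
        (pred-mono-≤ o<k))
      row)
    rj

lemma4p2 : (n : ℕ) (k : ℕ) → k ≤ 9 → (row : Fin 2) (a b : Fin n) →
           toℕ b ≡ toℕ a + k → (r : V n) →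
           toℕ a < toℕ (proj₁ r) → toℕ (proj₁ r) < toℕ b →
           CopWin [] (a , row) (b , row) r
lemma4p2 n k k≤9 row a b b≡a+k (ri , rj) a<r r<b =
  wins-sound (certificate k o ⌊ row Fin.≟ rj ⌋) start (ri≡a+o , refl)
             (start-verified k≤9 0<o o<k row rj)
  where
  open Soundness n (toℕ a) k (subst (_< n) b≡a+k (toℕ<n b))
  o = toℕ ri ∸ toℕ a
  ri≡a+o : toℕ ri ≡ toℕ a + o
  ri≡a+o = sym (m+[n∸m]≡n (<⇒≤ a<r))
  0<o : 0 < o
  0<o = m<n⇒0<n∸m a<r
  o<k : o < k
  o<k = +-cancelˡ-< (toℕ a) o k (subst₂ _<_ ri≡a+o b≡a+k r<b)
  start : Simulates [] (a , row) (b , row) [] (0 , row) (k , row)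
  start = record { burnt = [] ; cop₁ = sym (+-identityʳ (toℕ a)) , refl ; cop₂ = b≡a+k , refl
                 ; inside₁ = z≤n ; inside₂ = ≤-refl }
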